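{- Let $x\in\mathbb{Z}_2$, $k\in\mathbb{N}$ and $a\in\mathbb{N}$ with $a<2^k$, and let $m=\alpha(a)$. Then $$\Phi\left(a+2^kx\right)=\Phi(a)+\frac{\Phi(x)}{3^m}2^k.$$
   Context: $\mathbb{Z}_2$ is the ring of $2$-adic integers; $\mathbb{N}=\{0,1,2,\dots\}$. The map $\Phi:\mathbb{Z}_2\to\mathbb{Z}_2$ is defined as follows: if $x=\sum_i 2^{e_i}$ with $0\leq e_0<e_1<\cdots$ (finite or infinite sum; $x=0$ is the empty sum), then $\Phi(x)=-\sum_i 2^{e_i}3^{ -i}$ ($\Phi(0)=0$). For $a\in\mathbb{N}$ with binary expansion $a=\sum_i d_i2^i$, $d_i\in\{0,1\}$, $\alpha(a)=\sum_i d_i$ is the number of ones in its binary expansion. -}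

module Defs where

open import Data.Bool using (Bool; true; false; if_then_else_)
open import Data.Nat as ℕ using (ℕ; zero; suc; NonZero)
open import Data.Nat.Properties using (m^n≢0)
open import Data.Integer as ℤ using (ℤ; +_)
open import Data.Integer.DivMod using (_%ℕ_)
open import Relation.Binary.PropositionalEquality using (_≡_)

-- 2-adic integers, represented canonically by their binary digit
-- streams: x = Σ_i (digit x i) 2^i.  Since the binary expansion of a
-- 2-adic integer is unique, equality of 2-adic integers is pointwise
-- equality of digits.

record ℤ₂ : Set where
  constructor mkℤ₂
  field digit : ℕ → Bool
open ℤ₂ public

infix 4 _≈₂_
_≈₂_ : ℤ₂ → ℤ₂ → Set
x ≈₂ y = ∀ i → digit x i ≡ digit y i

bit : Bool → ℕ
bit true  = 1
bit false = 0

⟦_⟧ : ℤ₂ → ℕ → ℕ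
⟦ x ⟧ zero    = 0
⟦ x ⟧ (suc n) = ⟦ x ⟧ n ℕ.+ bit (digit x n) ℕ.* 2 ℕ.^ n

-- From a coherent sequence of integer approximations s n (with
-- s (n+1) ≡ s n mod 2^n), i.e. an element of lim ℤ/2^n, to the 2-adic
-- integer: digit j is the j-th binary digit of s (j+1) mod 2^(j+1).
fromSeq : (ℕ → ℤ) → ℤ₂
digit (fromSeq s) j =
  ℕ._≡ᵇ_ (ℕ._%_ (ℕ._/_ (_%ℕ_ (s (suc j)) (2 ℕ.^ suc j) {{m^n≢0 2 (suc j)}})
                        (2 ℕ.^ j) {{m^n≢0 2 j}}) 2) 1

infixl 6 _+₂_
infixl 7 _*₂_
_+₂_ : ℤ₂ → ℤ₂ → ℤ₂
x +₂ y = fromSeq (λ n → + ⟦ x ⟧ n ℤ.+ + ⟦ y ⟧ n)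

_*₂_ : ℤ₂ → ℤ₂ → ℤ₂
x *₂ y = fromSeq (λ n → + ⟦ x ⟧ n ℤ.* + ⟦ y ⟧ n)

-₂_ : ℤ₂ → ℤ₂
-₂ x = fromSeq (λ n → ℤ.- (+ ⟦ x ⟧ n))

fromℤ : ℤ → ℤ₂
fromℤ c = fromSeq (λ _ → c)

ι : ℕ → ℤ₂
ι a = fromℤ (+ a)

0₂ : ℤ₂
0₂ = ι 0

infixr 8 _^₂_
_^₂_ : ℤ₂ → ℕ → ℤ₂
x ^₂ zero    = ι 1
x ^₂ suc n   = x *₂ (x ^₂ n)

-- 3⁻¹ ∈ ℤ₂: modulo 2^n the inverse of 3 is 3^(2^n - 1), since the
-- order of 3 in (ℤ/2^n)^× divides 2^n.
inv3 : ℤ₂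
inv3 = fromSeq (λ n → + (3 ℕ.^ (2 ℕ.^ n ℕ.∸ 1)))

Σ₂ : ℕ → (ℕ → ℤ₂) → ℤ₂
Σ₂ zero    f = 0₂
Σ₂ (suc n) f = Σ₂ n f +₂ f n

-- number of ones among the digits of x at positions < j
-- (so if digit x j = 1, then j = e_i with i = onesBelow x j)
onesBelow : ℤ₂ → ℕ → ℕ
onesBelow x zero    = 0
onesBelow x (suc j) = onesBelow x j ℕ.+ bit (digit x j)

ΦPartial : ℤ₂ → ℕ → ℤ₂
ΦPartial x n =
  -₂ Σ₂ n (λ j → if digit x j
                   then (ι 2 ^₂ j) *₂ (inv3 ^₂ onesBelow x j)
                   else 0₂)

-- Φ(x) = -Σ_i 2^{e_i} 3^{-i}, the 2-adic limit of the partial sums: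
-- modulo 2^n it agrees with the partial sum over e_i < n (later terms
-- are divisible by 2^n).
Φ : ℤ₂ → ℤ₂
Φ x = fromSeq (λ n → + ⟦ ΦPartial x n ⟧ n)

-- α(a): number of ones in the binary expansion of a ∈ ℕ.
-- (binary digits of a at positions i < a suffice, as a < 2^a)
α : ℕ → ℕ
α a = go a
  where
  go : ℕ → ℕ
  go zero    = 0
  go (suc i) = go i ℕ.+ ℕ._%_ (ℕ._/_ a (2 ℕ.^ i) {{m^n≢0 2 i}}) 2

{-# OPTIONS --safe #-}
module Submission where

-- Modulo 2^n, Φ z is minus the finite sum of the terms 2^j 3^{-i} over the ones j = e_i
-- of z below position n, with 3⁻¹ replaced by 3^(2^n - 1); so everything is proved as a
-- congruence of integers modulo 2^n and only then read back as equality of digits.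
-- The digits of y = a + 2^k x are those of a below position k and those of x, shifted
-- by k, above it, so y has α(a) plus (the ones of x below l) ones below k + l.  Hence
-- the terms of Φ y are those of Φ a below position k, and from there on 2^k 3^{-α(a)}
-- times those of Φ x.

open import Data.Bool using (true; false; if_then_else_)
open import Data.Empty using (⊥-elim)
open import Data.Integer as ℤ using (ℤ; +_; -[1+_]; _+_; _*_; -_; _-_)
import Data.Integer.Properties as ℤP
open import Data.Integer.DivMod using (_%ℕ_; _/ℕ_; a≡a%ℕn+[a/ℕn]*n; n%ℕd<d)
open import Data.Integer.Tactic.RingSolver using (solve-∀)
open import Data.Nat as ℕ using (ℕ; zero; suc; z≤n; s≤s; _<_; _^_)
import Data.Nat.DivMod as ℕD
import Data.Nat.Properties as ℕP
import Data.Nat.Tactic.RingSolver as ℕSolver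
open import Data.Sum using (inj₁; inj₂)
open import Level using (0ℓ)
open import Relation.Binary.Bundles using (Setoid)
import Relation.Binary.Reasoning.Setoid as SetoidReasoning
open import Relation.Binary.PropositionalEquality

open import Defs

2^_ : ℕ → ℤ
2^ n = (+ 2) ℤ.^ n

pos-^ : ∀ m n → + (m ^ n) ≡ (+ m) ℤ.^ n
pos-^ m zero    = refl
pos-^ m (suc n) = trans (ℤP.pos-* m (m ^ n)) (cong (+ m *_) (pos-^ m n))

-- Congruence modulo 2^n

infix 4 _≡_[mod2^_]
infixr 4 _,_
record _≡_[mod2^_] (a b : ℤ) (n : ℕ) : Set where
  constructor _,_
  field
    quotient : ℤ
    equation : a ≡ b + quotient * 2^ n

mod-refl : ∀ {a n} → a ≡ a [mod2^ n ]
mod-refl {a} {n} = + 0 , sym (trans (cong (_+_ a) (ℤP.*-zeroˡ (2^ n))) (ℤP.+-identityʳ a))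

≡⇒mod : ∀ {a b n} → a ≡ b → a ≡ b [mod2^ n ]
≡⇒mod refl = mod-refl

mod-sym : ∀ {a b n} → a ≡ b [mod2^ n ] → b ≡ a [mod2^ n ]
mod-sym {b = b} {n} (q , refl) = - q , identity b q (2^ n)
  where
  identity : ∀ b q P → b ≡ (b + q * P) + - q * P
  identity = solve-∀

mod-trans : ∀ {a b c n} → a ≡ b [mod2^ n ] → b ≡ c [mod2^ n ] → a ≡ c [mod2^ n ]
mod-trans {c = c} {n} (q , refl) (r , refl) = r + q , identity c q r (2^ n)
  where
  identity : ∀ c q r P → (c + r * P) + q * P ≡ c + (r + q) * P
  identity = solve-∀

mod-+ : ∀ {a b c d n} → a ≡ b [mod2^ n ] → c ≡ d [mod2^ n ] → a + c ≡ b + d [mod2^ n ]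
mod-+ {b = b} {d = d} {n} (q , refl) (r , refl) = q + r , identity b d q r (2^ n)
  where
  identity : ∀ b d q r P → (b + q * P) + (d + r * P) ≡ b + d + (q + r) * P
  identity = solve-∀

mod-* : ∀ {a b c d n} → a ≡ b [mod2^ n ] → c ≡ d [mod2^ n ] → a * c ≡ b * d [mod2^ n ]
mod-* {b = b} {d = d} {n} (q , refl) (r , refl) =
  q * d + b * r + q * r * 2^ n , identity b d q r (2^ n)
  where
  identity : ∀ b d q r P → (b + q * P) * (d + r * P) ≡ b * d + (q * d + b * r + q * r * P) * P
  identity = solve-∀

mod-neg : ∀ {a b n} → a ≡ b [mod2^ n ] → - a ≡ - b [mod2^ n ]
mod-neg {b = b} {n} (q , refl) = - q , identity b q (2^ n)
  where
  identity : ∀ b q P → - (b + q * P) ≡ - b + - q * P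
  identity = solve-∀

mod-^ : ∀ {a b n} k → a ≡ b [mod2^ n ] → a ℤ.^ k ≡ b ℤ.^ k [mod2^ n ]
mod-^ zero    a≡b = mod-refl
mod-^ (suc k) a≡b = mod-* a≡b (mod-^ k a≡b)

mod-zero : ∀ a b → a ≡ b [mod2^ 0 ]
mod-zero a b = a - b , identity a b
  where
  identity : ∀ a b → a ≡ b + (a - b) * + 1
  identity = solve-∀

mod-weaken : ∀ {a b m n} → m ℕ.≤ n → a ≡ b [mod2^ n ] → a ≡ b [mod2^ m ]
mod-weaken {b = b} {m} {n} m≤n (q , refl) = q * 2^ (n ℕ.∸ m) , (begin
  b + q * 2^ n                        ≡⟨ cong (λ e → b + q * 2^ e) (sym (ℕP.m+[n∸m]≡n m≤n)) ⟩
  b + q * 2^ (m ℕ.+ (n ℕ.∸ m))        ≡⟨ cong (λ P → b + q * P) (ℤP.^-distribˡ-+-* (+ 2) m (n ℕ.∸ m)) ⟩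
  b + q * (2^ m * 2^ (n ℕ.∸ m))       ≡⟨ identity b q (2^ m) (2^ (n ℕ.∸ m)) ⟩
  b + q * 2^ (n ℕ.∸ m) * 2^ m         ∎)
  where
  open ≡-Reasoning
  identity : ∀ b q P R → b + q * (P * R) ≡ b + q * R * P
  identity = solve-∀

2^*-mod-0 : ∀ c n → 2^ n * c ≡ + 0 [mod2^ n ]
2^*-mod-0 c n = c , trans (ℤP.*-comm (2^ n) c) (sym (ℤP.+-identityˡ (c * 2^ n)))

mod-2^* : ∀ {a b} k l → a ≡ b [mod2^ l ] → 2^ k * a ≡ 2^ k * b [mod2^ k ℕ.+ l ]
mod-2^* {b = b} k l (q , refl) = q ,
  trans (identity b q (2^ k) (2^ l)) (cong (λ P → 2^ k * b + q * P) (sym (ℤP.^-distribˡ-+-* (+ 2) k l)))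
  where
  identity : ∀ b q K P → K * (b + q * P) ≡ K * b + q * (K * P)
  identity = solve-∀

pos-+-*2^ : ∀ s q n → + (s ℕ.+ q ℕ.* 2 ^ n) ≡ + s + + q * 2^ n
pos-+-*2^ s q n = trans (ℤP.pos-+ s _) (cong (_+_ (+ s)) (trans (ℤP.pos-* q _) (cong (+ q *_) (pos-^ 2 n))))

pos-mod : ∀ {r s n} q → r ≡ s ℕ.+ q ℕ.* 2 ^ n → + r ≡ + s [mod2^ n ]
pos-mod {s = s} {n} q refl = + q , pos-+-*2^ s q n

mod2^-setoid : ℕ → Setoid 0ℓ 0ℓ
mod2^-setoid n = record
  { Carrier       = ℤ
  ; _≈_           = λ a b → a ≡ b [mod2^ n ]
  ; isEquivalence = record { refl = mod-refl ; sym = mod-sym ; trans = mod-trans }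
  }

module mod2^-Reasoning (n : ℕ) = SetoidReasoning (mod2^-setoid n)

2^≤-of-positive-quotient : ∀ {r s t n} → + r ≡ + s + + suc t * 2^ n → 2 ^ n ℕ.≤ r
2^≤-of-positive-quotient {r} {s} {t} {n} eq = begin
  2 ^ n                   ≤⟨ ℕP.m≤m+n (2 ^ n) (t ℕ.* 2 ^ n) ⟩
  suc t ℕ.* 2 ^ n         ≤⟨ ℕP.m≤n+m _ s ⟩
  s ℕ.+ suc t ℕ.* 2 ^ n   ≡⟨ ℤP.+-injective (sym (trans eq (sym (pos-+-*2^ s (suc t) n)))) ⟩
  r                       ∎
  where open ℕP.≤-Reasoning

residue-unique : ∀ {r s n} → r < 2 ^ n → s < 2 ^ n → + r ≡ + s [mod2^ n ] → r ≡ s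
residue-unique {r} {s} {n} _ _ (+ zero , eq) =
  ℤP.+-injective (trans eq (trans (cong (_+_ (+ s)) (ℤP.*-zeroˡ (2^ n))) (ℤP.+-identityʳ (+ s))))
residue-unique {n = n} r<2^n _ (+ suc t , eq) =
  ⊥-elim (ℕP.<⇒≱ r<2^n (2^≤-of-positive-quotient {t = t} {n = n} eq))
residue-unique {r} {s} {n} _ s<2^n (-[1+ t ] , eq) =
  ⊥-elim (ℕP.<⇒≱ s<2^n (2^≤-of-positive-quotient {t = t} {n = n} s≡))
  where
  identity : ∀ s q P → s ≡ (s + - q * P) + q * P
  identity = solve-∀
  s≡ : + s ≡ + r + + suc t * 2^ n
  s≡ = trans (identity (+ s) (+ suc t) (2^ n)) (cong (_+ + suc t * 2^ n) (sym eq))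

-- Residues of 2-adic integers and approximating sequences

bit≤1 : ∀ b → bit b ℕ.≤ 1
bit≤1 true  = ℕP.≤-refl
bit≤1 false = z≤n

bit-injective : ∀ {b c} → bit b ≡ bit c → b ≡ c
bit-injective {true}  {true}  _ = refl
bit-injective {false} {false} _ = refl

bit-≡ᵇ1 : ∀ {e} → e < 2 → bit (e ℕ.≡ᵇ 1) ≡ e
bit-≡ᵇ1 {0} _ = refl
bit-≡ᵇ1 {1} _ = refl
bit-≡ᵇ1 {suc (suc _)} (s≤s (s≤s ()))

⟦⟧<2^ : ∀ x n → ⟦ x ⟧ n < 2 ^ n
⟦⟧<2^ x zero    = s≤s z≤n
⟦⟧<2^ x (suc n) = begin-strict
  ⟦ x ⟧ n ℕ.+ bit (digit x n) ℕ.* 2 ^ n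
    ≤⟨ ℕP.+-monoʳ-≤ (⟦ x ⟧ n) (ℕP.*-monoˡ-≤ (2 ^ n) (bit≤1 (digit x n))) ⟩
  ⟦ x ⟧ n ℕ.+ 1 ℕ.* 2 ^ n
    <⟨ ℕP.+-monoˡ-< (1 ℕ.* 2 ^ n) (⟦⟧<2^ x n) ⟩
  2 ^ n ℕ.+ 1 ℕ.* 2 ^ n ∎
  where open ℕP.≤-Reasoning

digit-unique : ∀ x j c → ⟦ x ⟧ (suc j) ≡ ⟦ x ⟧ j ℕ.+ bit c ℕ.* 2 ^ j → digit x j ≡ c
digit-unique x j c eq =
  bit-injective (ℕP.*-cancelʳ-≡ _ _ (2 ^ j) {{ℕP.m^n≢0 2 j}} (ℕP.+-cancelˡ-≡ (⟦ x ⟧ j) _ _ eq))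

digit-cong : ∀ x y j → ⟦ x ⟧ j ≡ ⟦ y ⟧ j → ⟦ x ⟧ (suc j) ≡ ⟦ y ⟧ (suc j) → digit x j ≡ digit y j
digit-cong x y j eq eq′ =
  digit-unique x j (digit y j) (trans eq′ (cong (ℕ._+ bit (digit y j) ℕ.* 2 ^ j) (sym eq)))

Coherent : (ℕ → ℤ) → Set
Coherent s = ∀ n → s (suc n) ≡ s n [mod2^ n ]

coherent-+ : ∀ {s} → Coherent s → ∀ r i → s (r ℕ.+ i) ≡ s i [mod2^ i ]
coherent-+ coh zero    i = mod-refl
coherent-+ coh (suc r) i = mod-trans (mod-weaken (ℕP.m≤n+m i r) (coh (r ℕ.+ i))) (coherent-+ coh r i)

⟦⟧-coherent : ∀ x → Coherent (λ n → + ⟦ x ⟧ n)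
⟦⟧-coherent x n = pos-mod (bit (digit x n)) refl

infix 4 _∼_
_∼_ : ℤ₂ → (ℕ → ℤ) → Set
x ∼ f = ∀ n → + ⟦ x ⟧ n ≡ f n [mod2^ n ]

∼-resp : ∀ {x f g} → x ∼ f → (∀ n → f n ≡ g n [mod2^ n ]) → x ∼ g
∼-resp x∼f f≡g n = mod-trans (x∼f n) (f≡g n)

∼⇒≈₂ : ∀ {x y f g} → x ∼ f → y ∼ g → (∀ n → f n ≡ g n [mod2^ n ]) → x ≈₂ y
∼⇒≈₂ {x} {y} x∼f y∼g f≡g j = digit-cong x y j (⟦⟧≡ j) (⟦⟧≡ (suc j))
  where
  ⟦⟧≡ : ∀ n → ⟦ x ⟧ n ≡ ⟦ y ⟧ n
  ⟦⟧≡ n = residue-unique (⟦⟧<2^ x n) (⟦⟧<2^ y n) (mod-trans (x∼f n) (mod-trans (f≡g n) (mod-sym (y∼g n))))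

fromSeq-∼ : ∀ s → Coherent s → fromSeq s ∼ s
fromSeq-∼ s coh zero    = mod-zero _ _
fromSeq-∼ s coh (suc n) = mod-trans (≡⇒mod (cong +_ ⟦⟧≡R)) (mod-sym s≡R)
  where
  instance
    _ = ℕP.m^n≢0 2 n
    _ = ℕP.m^n≢0 2 (suc n)
  R = s (suc n) %ℕ 2 ^ suc n
  s≡R : s (suc n) ≡ + R [mod2^ suc n ]
  s≡R = s (suc n) /ℕ 2 ^ suc n ,
    trans (a≡a%ℕn+[a/ℕn]*n (s (suc n)) (2 ^ suc n)) (cong (λ P → + R + s (suc n) /ℕ 2 ^ suc n * P) (pos-^ 2 (suc n)))
  R-split : R ≡ R ℕ.% 2 ^ n ℕ.+ R ℕ./ 2 ^ n ℕ.* 2 ^ n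
  R-split = ℕD.m≡m%n+[m/n]*n R (2 ^ n)
  low : ⟦ fromSeq s ⟧ n ≡ R ℕ.% 2 ^ n
  low = residue-unique (⟦⟧<2^ (fromSeq s) n) (ℕD.m%n<n R (2 ^ n)) (begin
    + ⟦ fromSeq s ⟧ n   ≈⟨ fromSeq-∼ s coh n ⟩
    s n                 ≈⟨ coh n ⟨
    s (suc n)           ≈⟨ mod-weaken (ℕP.n≤1+n n) s≡R ⟩
    + R                 ≈⟨ pos-mod (R ℕ./ 2 ^ n) R-split ⟩
    + (R ℕ.% 2 ^ n)     ∎)
    where open mod2^-Reasoning n
  high : bit (digit (fromSeq s) n) ≡ R ℕ./ 2 ^ n
  high = trans (bit-≡ᵇ1 (ℕD.m%n<n (R ℕ./ 2 ^ n) 2))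
    (ℕD.m<n⇒m%n≡m {n = 2} (ℕD.m<n*o⇒m/o<n (n%ℕd<d (s (suc n)) (2 ^ suc n))))
  ⟦⟧≡R : ⟦ fromSeq s ⟧ (suc n) ≡ R
  ⟦⟧≡R = trans (cong₂ (λ l h → l ℕ.+ h ℕ.* 2 ^ n) low high) (sym R-split)

fromℤ-∼ : ∀ c → fromℤ c ∼ λ _ → c
fromℤ-∼ c = fromSeq-∼ (λ _ → c) (λ _ → mod-refl)

ι-∼ : ∀ a → ι a ∼ λ _ → + a
ι-∼ a = fromℤ-∼ (+ a)

+₂-∼ : ∀ {x y f g} → x ∼ f → y ∼ g → x +₂ y ∼ λ n → f n + g n
+₂-∼ {x} {y} x∼f y∼g =
  ∼-resp (fromSeq-∼ _ (λ n → mod-+ (⟦⟧-coherent x n) (⟦⟧-coherent y n))) (λ n → mod-+ (x∼f n) (y∼g n))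

*₂-∼ : ∀ {x y f g} → x ∼ f → y ∼ g → x *₂ y ∼ λ n → f n * g n
*₂-∼ {x} {y} x∼f y∼g =
  ∼-resp (fromSeq-∼ _ (λ n → mod-* (⟦⟧-coherent x n) (⟦⟧-coherent y n))) (λ n → mod-* (x∼f n) (y∼g n))

-₂-∼ : ∀ {x f} → x ∼ f → -₂ x ∼ λ n → - f n
-₂-∼ {x} x∼f = ∼-resp (fromSeq-∼ _ (λ n → mod-neg (⟦⟧-coherent x n))) (λ n → mod-neg (x∼f n))

^₂-∼ : ∀ {x f} k → x ∼ f → x ^₂ k ∼ λ n → f n ℤ.^ k
^₂-∼ zero    x∼f = ι-∼ 1
^₂-∼ (suc k) x∼f = *₂-∼ x∼f (^₂-∼ k x∼f)

-- The inverse of 3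

3^2^-mod : ∀ n → + (3 ^ 2 ^ n) ≡ + 1 [mod2^ suc n ]
3^2^-mod zero    = + 1 , refl
3^2^-mod (suc n) with 3^2^-mod n
... | q , eq = q + q * q * 2^ n , (begin
  + (3 ^ 2 ^ suc n)
    ≡⟨ cong (λ e → + (3 ^ (2 ^ n ℕ.+ e))) (ℕP.+-identityʳ (2 ^ n)) ⟩
  + (3 ^ (2 ^ n ℕ.+ 2 ^ n))
    ≡⟨ cong +_ (ℕP.^-distribˡ-+-* 3 (2 ^ n) (2 ^ n)) ⟩
  + (3 ^ 2 ^ n ℕ.* 3 ^ 2 ^ n)
    ≡⟨ ℤP.pos-* (3 ^ 2 ^ n) (3 ^ 2 ^ n) ⟩
  + (3 ^ 2 ^ n) * + (3 ^ 2 ^ n)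
    ≡⟨ cong₂ _*_ eq eq ⟩
  (+ 1 + q * 2^ suc n) * (+ 1 + q * 2^ suc n)
    ≡⟨ square q (2^ n) ⟩
  + 1 + (q + q * q * 2^ n) * 2^ suc (suc n) ∎)
  where
  open ≡-Reasoning
  square : ∀ q P → (+ 1 + q * (+ 2 * P)) * (+ 1 + q * (+ 2 * P)) ≡ + 1 + (q + q * q * P) * (+ 2 * (+ 2 * P))
  square = solve-∀

inv3-approx : ℕ → ℤ
inv3-approx n = + (3 ^ (2 ^ n ℕ.∸ 1))

inv3-approx-coherent : Coherent inv3-approx
inv3-approx-coherent n = begin
  inv3-approx (suc n)
    ≡⟨ cong (λ e → + (3 ^ e)) (exponent (2 ^ n)) ⟩
  + (3 ^ (2 ^ n ℕ.∸ 1 ℕ.+ 2 ^ n))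
    ≡⟨ cong +_ (ℕP.^-distribˡ-+-* 3 (2 ^ n ℕ.∸ 1) (2 ^ n)) ⟩
  + (3 ^ (2 ^ n ℕ.∸ 1) ℕ.* 3 ^ 2 ^ n)
    ≡⟨ ℤP.pos-* (3 ^ (2 ^ n ℕ.∸ 1)) (3 ^ 2 ^ n) ⟩
  inv3-approx n * + (3 ^ 2 ^ n)
    ≈⟨ mod-* (mod-refl {inv3-approx n}) (mod-weaken (ℕP.n≤1+n n) (3^2^-mod n)) ⟩
  inv3-approx n * + 1
    ≡⟨ ℤP.*-identityʳ (inv3-approx n) ⟩
  inv3-approx n ∎
  where
  open mod2^-Reasoning n
  exponent : ∀ p → p ℕ.+ (p ℕ.+ 0) ℕ.∸ 1 ≡ p ℕ.∸ 1 ℕ.+ p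
  exponent zero    = refl
  exponent (suc p) = cong (p ℕ.+_) (ℕP.+-identityʳ (suc p))

inv3-∼ : inv3 ∼ inv3-approx
inv3-∼ = fromSeq-∼ inv3-approx inv3-approx-coherent

-- Approximations of Φ

Σℤ : ℕ → (ℕ → ℤ) → ℤ
Σℤ zero    f = + 0
Σℤ (suc n) f = Σℤ n f + f n

Σℤ-cong : ∀ n {f g} → (∀ j → j < n → f j ≡ g j) → Σℤ n f ≡ Σℤ n g
Σℤ-cong zero    f≡g = refl
Σℤ-cong (suc n) f≡g = cong₂ _+_ (Σℤ-cong n (λ j j<n → f≡g j (ℕP.m<n⇒m<1+n j<n))) (f≡g n (ℕP.n<1+n n))

Σℤ-mod : ∀ n {f g m} → (∀ j → f j ≡ g j [mod2^ m ]) → Σℤ n f ≡ Σℤ n g [mod2^ m ]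
Σℤ-mod zero    f≡g = mod-refl
Σℤ-mod (suc n) f≡g = mod-+ (Σℤ-mod n f≡g) (f≡g n)

Σℤ-zero : ∀ n {f} → (∀ j → f j ≡ + 0) → Σℤ n f ≡ + 0
Σℤ-zero zero    f≡0 = refl
Σℤ-zero (suc n) f≡0 = cong₂ _+_ (Σℤ-zero n f≡0) (f≡0 n)

Σℤ-+ : ∀ k i f → Σℤ (k ℕ.+ i) f ≡ Σℤ k f + Σℤ i (λ l → f (k ℕ.+ l))
Σℤ-+ k zero    f = trans (cong (λ n → Σℤ n f) (ℕP.+-identityʳ k)) (sym (ℤP.+-identityʳ (Σℤ k f)))
Σℤ-+ k (suc i) f = begin
  Σℤ (k ℕ.+ suc i) f                                       ≡⟨ cong (λ n → Σℤ n f) (ℕP.+-suc k i) ⟩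
  Σℤ (k ℕ.+ i) f + f (k ℕ.+ i)                             ≡⟨ cong (_+ f (k ℕ.+ i)) (Σℤ-+ k i f) ⟩
  Σℤ k f + Σℤ i (λ l → f (k ℕ.+ l)) + f (k ℕ.+ i)          ≡⟨ ℤP.+-assoc (Σℤ k f) _ _ ⟩
  Σℤ k f + (Σℤ i (λ l → f (k ℕ.+ l)) + f (k ℕ.+ i))        ∎
  where open ≡-Reasoning

Σℤ-*ˡ : ∀ n c f → Σℤ n (λ j → c * f j) ≡ c * Σℤ n f
Σℤ-*ˡ zero    c f = sym (ℤP.*-zeroʳ c)
Σℤ-*ˡ (suc n) c f = trans (cong (_+ c * f n) (Σℤ-*ˡ n c f)) (sym (ℤP.*-distribˡ-+ c (Σℤ n f) (f n)))

Σ₂-∼ : ∀ n (t : ℕ → ℤ₂) (g : ℕ → ℕ → ℤ) → (∀ j → t j ∼ λ m → g m j) → Σ₂ n t ∼ λ m → Σℤ n (g m)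
Σ₂-∼ zero    t g t∼g = ι-∼ 0
Σ₂-∼ (suc n) t g t∼g = +₂-∼ (Σ₂-∼ n t g t∼g) (t∼g n)

-- `ΦSum z m n` approximates, modulo 2^m, the partial sum of `Φ z` (without its sign)
-- over the positions below n.
ΦTerm : ℤ₂ → ℕ → ℕ → ℤ
ΦTerm z m j = if digit z j then 2^ j * inv3-approx m ℤ.^ onesBelow z j else + 0

ΦSum : ℤ₂ → ℕ → ℕ → ℤ
ΦSum z m n = Σℤ n (ΦTerm z m)

ΦTerm-∼ : ∀ z j → (if digit z j then (ι 2 ^₂ j) *₂ (inv3 ^₂ onesBelow z j) else 0₂) ∼ λ m → ΦTerm z m j
ΦTerm-∼ z j with digit z j
... | true  = *₂-∼ (^₂-∼ j (ι-∼ 2)) (^₂-∼ (onesBelow z j) inv3-∼)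
... | false = ι-∼ 0

ΦPartial-∼ : ∀ z n → ΦPartial z n ∼ λ m → - ΦSum z m n
ΦPartial-∼ z n = -₂-∼ (Σ₂-∼ n _ (ΦTerm z) (ΦTerm-∼ z))

ΦTerm-mod-0 : ∀ z m j → ΦTerm z m j ≡ + 0 [mod2^ j ]
ΦTerm-mod-0 z m j with digit z j
... | true  = 2^*-mod-0 (inv3-approx m ℤ.^ onesBelow z j) j
... | false = mod-refl

ΦTerm-coherent : ∀ z j → Coherent (λ m → ΦTerm z m j)
ΦTerm-coherent z j m with digit z j
... | true  = mod-* (mod-refl {2^ j}) (mod-^ (onesBelow z j) (inv3-approx-coherent m))
... | false = mod-refl

ΦSum-+ : ∀ z m r i → ΦSum z m (r ℕ.+ i) ≡ ΦSum z m i [mod2^ i ]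
ΦSum-+ z m zero    i = mod-refl
ΦSum-+ z m (suc r) i = begin
  ΦSum z m (r ℕ.+ i) + ΦTerm z m (r ℕ.+ i)
    ≈⟨ mod-+ (ΦSum-+ z m r i) (mod-weaken (ℕP.m≤n+m i r) (ΦTerm-mod-0 z m (r ℕ.+ i))) ⟩
  ΦSum z m i + + 0
    ≡⟨ ℤP.+-identityʳ (ΦSum z m i) ⟩
  ΦSum z m i ∎
  where open mod2^-Reasoning i

Φ-∼ : ∀ z → Φ z ∼ λ n → - ΦSum z n n
Φ-∼ z = ∼-resp (fromSeq-∼ s coh) (λ n → ΦPartial-∼ z n n)
  where
  s : ℕ → ℤ
  s n = + ⟦ ΦPartial z n ⟧ n
  coh : Coherent s
  coh n = begin
    s (suc n)                    ≈⟨ mod-weaken (ℕP.n≤1+n n) (ΦPartial-∼ z (suc n) (suc n)) ⟩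
    - ΦSum z (suc n) (suc n)     ≈⟨ mod-neg (ΦSum-+ z (suc n) 1 n) ⟩
    - ΦSum z (suc n) n           ≈⟨ mod-neg (Σℤ-mod n (λ j → ΦTerm-coherent z j n)) ⟩
    - ΦSum z n n                 ≈⟨ ΦPartial-∼ z n n ⟨
    s n                          ∎
    where open mod2^-Reasoning n

-- The binary weight α

-- `α a` unfolds to `go a a` for the local function `go` of its definition, which
-- cannot be named from outside; `countOnes` is that `go`, found by unification in `α-unfold`.
mutual
  countOnes : ℕ → ℕ → ℕ
  countOnes = _

  private
    α-unfold : ∀ n → α (suc n) ≡ countOnes (suc n) n ℕ.+ (suc n ℕ./ 2 ^ n) {{ℕP.m^n≢0 2 n}} ℕ.% 2
    α-unfold n with suc n
    ... | m = refl

n<2^n : ∀ n → n < 2 ^ n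
n<2^n zero    = s≤s z≤n
n<2^n (suc n) = ℕP.+-mono-≤ (ℕP.m^n>0 2 n) (ℕP.≤-trans (n<2^n n) (ℕP.≤-reflexive (sym (ℕP.+-identityʳ (2 ^ n)))))

<2^-mono : ∀ {a i j} → i ℕ.≤ j → a < 2 ^ i → a < 2 ^ j
<2^-mono i≤j a<2^i = ℕP.<-≤-trans a<2^i (ℕP.^-monoʳ-≤ 2 i≤j)

bit-digit-ι : ∀ a j → bit (digit (ι a) j) ≡ (a ℕ./ 2 ^ j) {{ℕP.m^n≢0 2 j}} ℕ.% 2
bit-digit-ι a j = begin
  bit (digit (ι a) j)               ≡⟨ bit-≡ᵇ1 (ℕD.m%n<n (a ℕ.% 2 ^ suc j ℕ./ 2 ^ j) 2) ⟩
  a ℕ.% (2 ℕ.* 2 ^ j) ℕ./ 2 ^ j ℕ.% 2 ≡⟨ cong (ℕ._% 2) (ℕD.m%[n*o]/o≡m/o%n a 2 (2 ^ j)) ⟩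
  a ℕ./ 2 ^ j ℕ.% 2 ℕ.% 2           ≡⟨ ℕD.m%n%n≡m%n (a ℕ./ 2 ^ j) 2 ⟩
  a ℕ./ 2 ^ j ℕ.% 2                 ∎
  where
  open ≡-Reasoning
  instance
    _ = ℕP.m^n≢0 2 j
    _ = ℕP.m^n≢0 2 (suc j)

onesBelow-ι : ∀ a i → onesBelow (ι a) i ≡ countOnes a i
onesBelow-ι a zero    = refl
onesBelow-ι a (suc i) = cong₂ ℕ._+_ (onesBelow-ι a i) (bit-digit-ι a i)

⟦ι⟧ : ∀ {a} j → a < 2 ^ j → ⟦ ι a ⟧ j ≡ a
⟦ι⟧ {a} j a<2^j = residue-unique (⟦⟧<2^ (ι a) j) a<2^j (ι-∼ a j)

digit-ι-high : ∀ {a} j → a < 2 ^ j → digit (ι a) j ≡ false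
digit-ι-high {a} j a<2^j = digit-unique (ι a) j false (begin
  ⟦ ι a ⟧ (suc j)     ≡⟨ ⟦ι⟧ (suc j) (<2^-mono (ℕP.n≤1+n j) a<2^j) ⟩
  a                   ≡⟨ ⟦ι⟧ j a<2^j ⟨
  ⟦ ι a ⟧ j           ≡⟨ ℕP.+-identityʳ (⟦ ι a ⟧ j) ⟨
  ⟦ ι a ⟧ j ℕ.+ 0     ∎)
  where open ≡-Reasoning

onesBelow-ι-+ : ∀ {a i} → a < 2 ^ i → ∀ r → onesBelow (ι a) (r ℕ.+ i) ≡ onesBelow (ι a) i
onesBelow-ι-+         a<2^i zero    = refl
onesBelow-ι-+ {a} {i} a<2^i (suc r) = begin
  onesBelow (ι a) (r ℕ.+ i) ℕ.+ bit (digit (ι a) (r ℕ.+ i))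
    ≡⟨ cong (λ d → onesBelow (ι a) (r ℕ.+ i) ℕ.+ bit d) (digit-ι-high (r ℕ.+ i) (<2^-mono (ℕP.m≤n+m i r) a<2^i)) ⟩
  onesBelow (ι a) (r ℕ.+ i) ℕ.+ 0
    ≡⟨ ℕP.+-identityʳ _ ⟩
  onesBelow (ι a) (r ℕ.+ i)
    ≡⟨ onesBelow-ι-+ a<2^i r ⟩
  onesBelow (ι a) i ∎
  where open ≡-Reasoning

α≡onesBelow-ι : ∀ {a} k → a < 2 ^ k → α a ≡ onesBelow (ι a) k
α≡onesBelow-ι {a} k a<2^k = begin
  α a                       ≡⟨ onesBelow-ι a a ⟨
  onesBelow (ι a) a         ≡⟨ onesBelow-ι-+ (n<2^n a) k ⟨
  onesBelow (ι a) (k ℕ.+ a) ≡⟨ cong (onesBelow (ι a)) (ℕP.+-comm k a) ⟩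
  onesBelow (ι a) (a ℕ.+ k) ≡⟨ onesBelow-ι-+ a<2^k a ⟩
  onesBelow (ι a) k         ∎
  where open ≡-Reasoning

-- The digits of a + 2^k x

module Concatenation (x : ℤ₂) (k a : ℕ) (a<2^k : a < 2 ^ k) where

  y : ℤ₂
  y = ι a +₂ (ι 2 ^₂ k) *₂ x

  y-∼ : y ∼ λ n → + a + 2^ k * + ⟦ x ⟧ n
  y-∼ = +₂-∼ (ι-∼ a) (*₂-∼ (^₂-∼ k (ι-∼ 2)) (λ n → mod-refl))

  ⟦y⟧-low : ∀ n → n ℕ.≤ k → ⟦ y ⟧ n ≡ ⟦ ι a ⟧ n
  ⟦y⟧-low n n≤k = residue-unique (⟦⟧<2^ y n) (⟦⟧<2^ (ι a) n) (begin
    + ⟦ y ⟧ n                ≈⟨ y-∼ n ⟩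
    + a + 2^ k * + ⟦ x ⟧ n   ≈⟨ mod-+ (mod-refl {+ a}) (mod-weaken n≤k (2^*-mod-0 (+ ⟦ x ⟧ n) k)) ⟩
    + a + + 0                ≡⟨ ℤP.+-identityʳ (+ a) ⟩
    + a                      ≈⟨ ι-∼ a n ⟨
    + ⟦ ι a ⟧ n              ∎)
    where open mod2^-Reasoning n

  a+2^k*⟦x⟧<2^ : ∀ l → a ℕ.+ 2 ^ k ℕ.* ⟦ x ⟧ l < 2 ^ (k ℕ.+ l)
  a+2^k*⟦x⟧<2^ l = begin-strict
    a ℕ.+ 2 ^ k ℕ.* ⟦ x ⟧ l        <⟨ ℕP.+-monoˡ-< (2 ^ k ℕ.* ⟦ x ⟧ l) a<2^k ⟩
    2 ^ k ℕ.+ 2 ^ k ℕ.* ⟦ x ⟧ l    ≡⟨ ℕP.*-suc (2 ^ k) (⟦ x ⟧ l) ⟨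
    2 ^ k ℕ.* suc (⟦ x ⟧ l)        ≤⟨ ℕP.*-monoʳ-≤ (2 ^ k) (⟦⟧<2^ x l) ⟩
    2 ^ k ℕ.* 2 ^ l                ≡⟨ ℕP.^-distribˡ-+-* 2 k l ⟨
    2 ^ (k ℕ.+ l)                  ∎
    where open ℕP.≤-Reasoning

  ⟦y⟧-high : ∀ l → ⟦ y ⟧ (k ℕ.+ l) ≡ a ℕ.+ 2 ^ k ℕ.* ⟦ x ⟧ l
  ⟦y⟧-high l = residue-unique (⟦⟧<2^ y (k ℕ.+ l)) (a+2^k*⟦x⟧<2^ l) (begin
    + ⟦ y ⟧ (k ℕ.+ l)
      ≈⟨ y-∼ (k ℕ.+ l) ⟩
    + a + 2^ k * + ⟦ x ⟧ (k ℕ.+ l)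
      ≈⟨ mod-+ (mod-refl {+ a}) (mod-2^* k l (coherent-+ (⟦⟧-coherent x) k l)) ⟩
    + a + 2^ k * + ⟦ x ⟧ l
      ≡⟨ pos-linear ⟨
    + (a ℕ.+ 2 ^ k ℕ.* ⟦ x ⟧ l) ∎)
    where
    open mod2^-Reasoning (k ℕ.+ l)
    pos-linear : + (a ℕ.+ 2 ^ k ℕ.* ⟦ x ⟧ l) ≡ + a + 2^ k * + ⟦ x ⟧ l
    pos-linear = trans (ℤP.pos-+ a _) (cong (_+_ (+ a)) (trans (ℤP.pos-* (2 ^ k) _) (cong (_* + ⟦ x ⟧ l) (pos-^ 2 k))))

  digit-y-low : ∀ j → j < k → digit y j ≡ digit (ι a) j
  digit-y-low j j<k = digit-cong y (ι a) j (⟦y⟧-low j (ℕP.<⇒≤ j<k)) (⟦y⟧-low (suc j) j<k)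

  digit-y-high : ∀ l → digit y (k ℕ.+ l) ≡ digit x l
  digit-y-high l = digit-unique y (k ℕ.+ l) (digit x l) (begin
    ⟦ y ⟧ (suc (k ℕ.+ l))
      ≡⟨ cong ⟦ y ⟧ (ℕP.+-suc k l) ⟨
    ⟦ y ⟧ (k ℕ.+ suc l)
      ≡⟨ ⟦y⟧-high (suc l) ⟩
    a ℕ.+ 2 ^ k ℕ.* (⟦ x ⟧ l ℕ.+ b ℕ.* 2 ^ l)
      ≡⟨ identity a (2 ^ k) (⟦ x ⟧ l) b (2 ^ l) ⟩
    a ℕ.+ 2 ^ k ℕ.* ⟦ x ⟧ l ℕ.+ b ℕ.* (2 ^ k ℕ.* 2 ^ l)
      ≡⟨ cong₂ (λ u v → u ℕ.+ b ℕ.* v) (⟦y⟧-high l) (ℕP.^-distribˡ-+-* 2 k l) ⟨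
    ⟦ y ⟧ (k ℕ.+ l) ℕ.+ b ℕ.* 2 ^ (k ℕ.+ l) ∎)
    where
    open ≡-Reasoning
    b = bit (digit x l)
    identity : ∀ a K X b L → a ℕ.+ K ℕ.* (X ℕ.+ b ℕ.* L) ≡ a ℕ.+ K ℕ.* X ℕ.+ b ℕ.* (K ℕ.* L)
    identity = ℕSolver.solve-∀

  onesBelow-y-low : ∀ n → n ℕ.≤ k → onesBelow y n ≡ onesBelow (ι a) n
  onesBelow-y-low zero    _   = refl
  onesBelow-y-low (suc n) n<k =
    cong₂ ℕ._+_ (onesBelow-y-low n (ℕP.<⇒≤ n<k)) (cong bit (digit-y-low n n<k))

  onesBelow-y-high : ∀ l → onesBelow y (k ℕ.+ l) ≡ α a ℕ.+ onesBelow x l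
  onesBelow-y-high zero = begin
    onesBelow y (k ℕ.+ 0)   ≡⟨ cong (onesBelow y) (ℕP.+-identityʳ k) ⟩
    onesBelow y k           ≡⟨ onesBelow-y-low k ℕP.≤-refl ⟩
    onesBelow (ι a) k       ≡⟨ α≡onesBelow-ι k a<2^k ⟨
    α a                     ≡⟨ ℕP.+-identityʳ (α a) ⟨
    α a ℕ.+ 0               ∎
    where open ≡-Reasoning
  onesBelow-y-high (suc l) = begin
    onesBelow y (k ℕ.+ suc l)
      ≡⟨ cong (onesBelow y) (ℕP.+-suc k l) ⟩
    onesBelow y (k ℕ.+ l) ℕ.+ bit (digit y (k ℕ.+ l))
      ≡⟨ cong₂ ℕ._+_ (onesBelow-y-high l) (cong bit (digit-y-high l)) ⟩
    α a ℕ.+ onesBelow x l ℕ.+ bit (digit x l)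
      ≡⟨ ℕP.+-assoc (α a) (onesBelow x l) _ ⟩
    α a ℕ.+ onesBelow x (suc l) ∎
    where open ≡-Reasoning

  ΦTerm-y-low : ∀ m j → j < k → ΦTerm y m j ≡ ΦTerm (ι a) m j
  ΦTerm-y-low m j j<k = cong₂ (λ d o → if d then 2^ j * inv3-approx m ℤ.^ o else + 0)
    (digit-y-low j j<k) (onesBelow-y-low j (ℕP.<⇒≤ j<k))

  ΦTerm-y-high : ∀ m l → ΦTerm y m (k ℕ.+ l) ≡ 2^ k * inv3-approx m ℤ.^ α a * ΦTerm x m l
  ΦTerm-y-high m l rewrite digit-y-high l | onesBelow-y-high l with digit x l
  ... | false = sym (ℤP.*-zeroʳ (2^ k * inv3-approx m ℤ.^ α a))
  ... | true  = begin
    2^ (k ℕ.+ l) * I ℤ.^ (α a ℕ.+ o)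
      ≡⟨ cong₂ _*_ (ℤP.^-distribˡ-+-* (+ 2) k l) (ℤP.^-distribˡ-+-* I (α a) o) ⟩
    2^ k * 2^ l * (I ℤ.^ α a * I ℤ.^ o)
      ≡⟨ identity (2^ k) (2^ l) (I ℤ.^ α a) (I ℤ.^ o) ⟩
    2^ k * I ℤ.^ α a * (2^ l * I ℤ.^ o) ∎
    where
    open ≡-Reasoning
    I = inv3-approx m
    o = onesBelow x l
    identity : ∀ K L A O → K * L * (A * O) ≡ K * A * (L * O)
    identity = solve-∀

  ΦTerm-ι-high : ∀ m l → ΦTerm (ι a) m (k ℕ.+ l) ≡ + 0
  ΦTerm-ι-high m l rewrite digit-ι-high (k ℕ.+ l) (<2^-mono (ℕP.m≤m+n k l) a<2^k) = refl

  ΦSum-ι-high : ∀ m i → ΦSum (ι a) m (k ℕ.+ i) ≡ ΦSum (ι a) m k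
  ΦSum-ι-high m i = begin
    ΦSum (ι a) m (k ℕ.+ i)
      ≡⟨ Σℤ-+ k i (ΦTerm (ι a) m) ⟩
    ΦSum (ι a) m k + Σℤ i (λ l → ΦTerm (ι a) m (k ℕ.+ l))
      ≡⟨ cong (_+_ (ΦSum (ι a) m k)) (Σℤ-zero i (ΦTerm-ι-high m)) ⟩
    ΦSum (ι a) m k + + 0
      ≡⟨ ℤP.+-identityʳ (ΦSum (ι a) m k) ⟩
    ΦSum (ι a) m k ∎
    where open ≡-Reasoning

  ΦSum-y-high : ∀ m i → ΦSum y m (k ℕ.+ i) ≡ ΦSum (ι a) m k + 2^ k * inv3-approx m ℤ.^ α a * ΦSum x m i
  ΦSum-y-high m i = begin
    ΦSum y m (k ℕ.+ i)
      ≡⟨ Σℤ-+ k i (ΦTerm y m) ⟩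
    ΦSum y m k + Σℤ i (λ l → ΦTerm y m (k ℕ.+ l))
      ≡⟨ cong₂ _+_ (Σℤ-cong k (λ j → ΦTerm-y-low m j)) (Σℤ-cong i (λ l _ → ΦTerm-y-high m l)) ⟩
    ΦSum (ι a) m k + Σℤ i (λ l → c * ΦTerm x m l)
      ≡⟨ cong (_+_ (ΦSum (ι a) m k)) (Σℤ-*ˡ i c (ΦTerm x m)) ⟩
    ΦSum (ι a) m k + c * ΦSum x m i ∎
    where
    open ≡-Reasoning
    c = 2^ k * inv3-approx m ℤ.^ α a

  Φ-y-congruence-at : ℕ → Set
  Φ-y-congruence-at n =
    - ΦSum y n n ≡ - ΦSum (ι a) n n + - ΦSum x n n * inv3-approx n ℤ.^ α a * 2^ k [mod2^ n ]

  Φ-y-congruence-low : ∀ n → n ℕ.≤ k → Φ-y-congruence-at n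
  Φ-y-congruence-low n n≤k = begin
    - ΦSum y n n                ≡⟨ cong -_ (Σℤ-cong n (λ j j<n → ΦTerm-y-low n j (ℕP.<-≤-trans j<n n≤k))) ⟩
    - ΦSum (ι a) n n            ≡⟨ ℤP.+-identityʳ _ ⟨
    - ΦSum (ι a) n n + + 0      ≈⟨ mod-+ (mod-refl { - ΦSum (ι a) n n}) (mod-weaken n≤k (2^*-mod-0 c k)) ⟨
    - ΦSum (ι a) n n + 2^ k * c ≡⟨ cong (_+_ (- ΦSum (ι a) n n)) (ℤP.*-comm (2^ k) c) ⟩
    - ΦSum (ι a) n n + c * 2^ k ∎
    where
    open mod2^-Reasoning n
    c = - ΦSum x n n * inv3-approx n ℤ.^ α a

  Φ-y-congruence-high : ∀ i → Φ-y-congruence-at (k ℕ.+ i)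
  Φ-y-congruence-high i = begin
    - ΦSum y n n
      ≡⟨ cong -_ (ΦSum-y-high n i) ⟩
    - (A + 2^ k * W * ΦSum x n i)
      ≡⟨ identity A (2^ k) W (ΦSum x n i) ⟩
    - A + 2^ k * (- ΦSum x n i * W)
      ≈⟨ mod-+ (mod-refl { - A}) (mod-2^* k i (mod-* (mod-neg (ΦSum-+ x n k i)) (mod-refl {W}))) ⟨
    - A + 2^ k * (- ΦSum x n n * W)
      ≡⟨ cong₂ (λ u v → - u + v) (ΦSum-ι-high n i) (ℤP.*-comm _ (2^ k)) ⟨
    - ΦSum (ι a) n n + - ΦSum x n n * W * 2^ k ∎
    where
    n = k ℕ.+ i
    open mod2^-Reasoning n
    A = ΦSum (ι a) n k
    W = inv3-approx n ℤ.^ α a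
    identity : ∀ A K W S → - (A + K * W * S) ≡ - A + K * (- S * W)
    identity = solve-∀

  Φ-y-congruence : ∀ n → Φ-y-congruence-at n
  Φ-y-congruence n with ℕP.≤-total n k
  ... | inj₁ n≤k = Φ-y-congruence-low n n≤k
  ... | inj₂ k≤n = subst Φ-y-congruence-at (ℕP.m+[n∸m]≡n k≤n) (Φ-y-congruence-high (n ℕ.∸ k))

theorem11 : (x : ℤ₂) (k a : ℕ) → a < 2 ^ k →
    Φ (ι a +₂ (ι 2 ^₂ k) *₂ x)
      ≈₂ Φ (ι a) +₂ (Φ x *₂ (inv3 ^₂ α a)) *₂ (ι 2 ^₂ k)
theorem11 x k a a<2^k =
  ∼⇒≈₂ (Φ-∼ y)
       (+₂-∼ (Φ-∼ (ι a)) (*₂-∼ (*₂-∼ (Φ-∼ x) (^₂-∼ (α a) inv3-∼)) (^₂-∼ k (ι-∼ 2))))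
       Φ-y-congruence
  where open Concatenation x k a a<2^k
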